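{- Every finite chordal bipartite graph $G$ with bipartition classes $U,W$ satisfies Frankl's conjecture: if $G$ has at least one edge, then each of $U$ and $W$ contains a vertex belonging to at most half of the maximal stable sets of $G$.
   Context: A chordal bipartite graph is a bipartite graph in which every cycle of length at least six has a chord. A set of vertices is stable if no two are adjacent; maximal means maximal under inclusion. (Edgeless graphs are considered to satisfy Frankl's conjecture trivially.) -}

module Defs where

open import Data.Nat using (ℕ; zero; suc; _+_; _*_; _≤_)
open import Data.Fin using (Fin; toℕ)
open import Data.Fin.Subset using (Subset; _∈_; _⊆_)
open import Data.Fin.Subset.Properties using (_∈?_)
open import Data.Bool using (Bool)
open import Data.List using (List; length; filter)
open import Data.List.Relation.Unary.Unique.Propositional using (Unique)
import Data.List.Membership.Propositional as LM
open import Data.Product using (Σ; ∃; ∃-syntax; _×_)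
open import Data.Sum using (_⊎_)
open import Function.Definitions using (Injective)
open import Relation.Nullary using (¬_)
open import Relation.Binary.PropositionalEquality using (_≡_)
open import Function.Bundles using (_⇔_)

record Graph (n : ℕ) : Set₁ where
  field
    Adj     : Fin n → Fin n → Set
    symm    : ∀ {x y} → Adj x y → Adj y x
    irrefl  : ∀ {x} → ¬ Adj x x
open Graph public

HasEdge : ∀ {n} → Graph n → Set
HasEdge G = ∃[ x ] ∃[ y ] Adj G x y

-- A bipartition of G into classes U = {v | side v ≡ false}, W = {v | side v ≡ true}:
-- every edge joins the two classes.
IsBipartition : ∀ {n} → Graph n → (Fin n → Bool) → Set
IsBipartition G side = ∀ x y → Adj G x y → ¬ (side x ≡ side y)

CycNext : ∀ {k} → Fin k → Fin k → Set
CycNext {k} i j = (suc (toℕ i) ≡ toℕ j) ⊎ ((suc (toℕ i) ≡ k) × (toℕ j ≡ 0))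

record Cycle {n} (G : Graph n) (k : ℕ) : Set where
  field
    len≥3  : 3 ≤ k
    vert   : Fin k → Fin n
    inj    : Injective _≡_ _≡_ vert
    edges  : ∀ i j → CycNext i j → Adj G (vert i) (vert j)
open Cycle public

HasChord : ∀ {n} {G : Graph n} {k} → Cycle G k → Set
HasChord {G = G} C =
  ∃[ i ] ∃[ j ] (Adj G (vert C i) (vert C j) × ¬ CycNext i j × ¬ CycNext j i)

ChordalBipartite : ∀ {n} → Graph n → (Fin n → Bool) → Set
ChordalBipartite G side =
  IsBipartition G side × (∀ k → 6 ≤ k → (C : Cycle G k) → HasChord C)

IsStable : ∀ {n} → Graph n → Subset n → Set
IsStable G S = ∀ x y → x ∈ S → y ∈ S → ¬ Adj G x y

IsMaximalStable : ∀ {n} → Graph n → Subset n → Set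
IsMaximalStable G S = IsStable G S × (∀ T → IsStable G T → S ⊆ T → T ⊆ S)

EnumeratesMaxStable : ∀ {n} → Graph n → List (Subset n) → Set
EnumeratesMaxStable G L = Unique L × (∀ S → (S LM.∈ L) ⇔ IsMaximalStable G S)

countContaining : ∀ {n} → Fin n → List (Subset n) → ℕ
countContaining v L = length (filter (v ∈?_) L)

AtMostHalf : ∀ {n} → Fin n → List (Subset n) → Set
AtMostHalf v L = 2 * countContaining v L ≤ length L

-- If u is a maximum neighbour of w in a bipartite graph (N(v) ⊆ N(u) for every v ∈ N(w)), then
-- S ↦ (S ∩ side(u) ∖ N(w)) ∪ {x ∉ side(u) with no neighbour there} maps the maximal stable sets
-- containing u injectively to maximal stable sets avoiding u, so u lies in at most half of them.
-- It remains to find, on each side, a vertex w with a maximum neighbour. In a chordal bipartite graph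
-- this goes by induction on vertex sets X, as Dirac's lemma on simplicial vertices: given u₀ ≁ w₀,
-- let C be the component of w₀ in X ∖ N[u₀]. Since there is no chordless cycle of length ≥ 6, some
-- c ∈ C is adjacent to every vertex of N(u₀) ∩ N(C); recurse either on C ∪ (N(u₀) ∩ N(C)) ∪ {u₀},
-- or, when that is all of X, on X ∖ {u₀} with c in place of u₀.
-- Adjacency is not assumed decidable, but the conclusion is, so the argument runs in the
-- double-negation monad.

module Submission where

open import Defs
open import Level using (0ℓ)
open import Data.Bool as Bool using (Bool; true; false; not)
open import Data.Bool.Properties using (¬-not)
open import Data.Empty using (⊥; ⊥-elim)
open import Data.Fin as Fin using (Fin; zero; suc; toℕ)
open import Data.Fin.Properties using (toℕ-injective; toℕ<n; any?)
open import Data.Fin.Subset using (Subset; _∈_; _∉_; _⊆_; _⊂_; ⊤)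
open import Data.Fin.Subset.Properties using (∈⊤; _∈?_; ⊆-antisym)
open import Data.Fin.Subset.Induction using (⊂-wellFounded)
open import Data.List using (List; []; _∷_; _++_; length; filter; allFin)
open import Data.List.Properties using (length-++-sucʳ)
open import Data.List.Membership.Propositional using () renaming (_∈_ to _∈ₗ_)
open import Data.List.Membership.Propositional.Properties
  using (∈-allFin; ∈-∃++; ∈-++⁻; ∈-++⁺ˡ; ∈-++⁺ʳ; ∈-filter⁺; ∈-filter⁻)
open import Data.List.Relation.Unary.All as All using (All; []; _∷_)
open import Data.List.Relation.Unary.All.Properties using (all-filter)
open import Data.List.Relation.Unary.Any using (here; there)
open import Data.List.Relation.Unary.Unique.Propositional using (Unique; []; _∷_)
open import Data.List.Relation.Unary.Unique.Propositional.Properties using (filter⁺)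
open import Data.Nat using (ℕ; zero; suc; _+_; _*_; _∸_; _≤_; _<_; z≤n; s≤s; z<s; s<s; _≤?_; _<?_)
open import Data.Nat.Induction using (<-rec)
open import Data.Nat.Properties
open import Data.Product using (∃; ∃-syntax; _×_; _,_; proj₁; proj₂)
open import Data.Sum using (_⊎_; inj₁; inj₂)
open import Data.Vec using (tabulate)
open import Data.Vec.Properties using ([]=⇒lookup; lookup⇒[]=; lookup∘tabulate)
open import Effect.Monad using (RawMonad)
open import Function using (_∘_)
open import Function.Bundles using (Equivalence)
import Induction.WellFounded as WF
open import Relation.Binary.Definitions using (tri<; tri≈; tri>)
open import Relation.Binary.PropositionalEquality using (_≡_; _≢_; refl; sym; trans; cong; subst; subst₂)
open import Relation.Nullary using (¬_; Dec; yes; no; does; contradiction)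
open import Relation.Nullary.Decidable
  using (_×-dec_; _⊎-dec_; ¬?; dec-true; ¬¬-excluded-middle; decidable-stable)
open import Relation.Nullary.Negation using (DoubleNegation; ¬¬-Monad)
open import Relation.Unary using (Pred; Decidable)
open import Relation.Unary.Properties using (∁?)

open RawMonad (¬¬-Monad {0ℓ}) using (pure; _>>=_; _<$>_)

-- Classical reasoning

¬¬-Π : ∀ {m} {P : Fin m → Set} → (∀ i → DoubleNegation (P i)) → DoubleNegation (∀ i → P i)
¬¬-Π {zero}  h = pure λ ()
¬¬-Π {suc m} h = do
  p₀ ← h zero
  ps ← ¬¬-Π (λ i → h (suc i))
  pure λ { zero → p₀ ; (suc i) → ps i }

¬¬-All : ∀ {A : Set} {P : Pred A 0ℓ} {xs : List A} →
         All (λ x → DoubleNegation (P x)) xs → DoubleNegation (All P xs)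
¬¬-All []       = pure []
¬¬-All (p ∷ ps) = do
  q  ← p
  qs ← ¬¬-All ps
  pure (q ∷ qs)

¬¬-least : ∀ {P : ℕ → Set} m → P m → DoubleNegation (∃ λ m₀ → P m₀ × ∀ {k} → k < m₀ → ¬ P k)
¬¬-least {P} = <-rec _ λ m rec p → do
  yes (k , k<m , q) ← ¬¬-excluded-middle {A = ∃ λ k → k < m × P k}
    where no ¬smaller → pure (m , p , λ {k} k<m q → ¬smaller (_ , k<m , q))
  rec k<m q

¬¬-Decidable : ∀ {n} (P : Pred (Fin n) 0ℓ) → DoubleNegation (Decidable P)
¬¬-Decidable P = ¬¬-Π (λ _ → ¬¬-excluded-middle)

-- Counting

module _ {A B : Set} where

  length-≤-injection : (f : A → B) (xs : List A) (ys : List B) → Unique xs →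
    (∀ {x} → x ∈ₗ xs → f x ∈ₗ ys) →
    (∀ {x y} → x ∈ₗ xs → y ∈ₗ xs → f x ≡ f y → x ≡ y) →
    length xs ≤ length ys
  length-≤-injection f []       ys _           _    _   = z≤n
  length-≤-injection f (x ∷ xs) ys (x∉xs ∷ xs!) into inj with ∈-∃++ (into (here refl))
  ... | ys₁ , ys₂ , refl = begin
    suc (length xs)            ≤⟨ s≤s (length-≤-injection f xs (ys₁ ++ ys₂) xs! into′ inj′) ⟩
    suc (length (ys₁ ++ ys₂))  ≡⟨ length-++-sucʳ ys₁ (f x) ys₂ ⟨
    length (ys₁ ++ f x ∷ ys₂)  ∎
    where
    open ≤-Reasoning
    inj′ : ∀ {y z} → y ∈ₗ xs → z ∈ₗ xs → f y ≡ f z → y ≡ z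
    inj′ y∈ z∈ = inj (there y∈) (there z∈)
    into′ : ∀ {y} → y ∈ₗ xs → f y ∈ₗ ys₁ ++ ys₂
    into′ {y} y∈ with ∈-++⁻ ys₁ (into (there y∈))
    ... | inj₁ p         = ∈-++⁺ˡ p
    ... | inj₂ (there p) = ∈-++⁺ʳ ys₁ p
    ... | inj₂ (here fy≡fx) =
      ⊥-elim (All.lookup x∉xs y∈ (inj (here refl) (there y∈) (sym fy≡fx)))

module _ {A : Set} {P : Pred A 0ℓ} (P? : Decidable P) where

  length-filter+filter-∁ : ∀ xs → length (filter P? xs) + length (filter (∁? P?) xs) ≡ length xs
  length-filter+filter-∁ []       = refl
  length-filter+filter-∁ (x ∷ xs) with does (P? x)
  ... | true  = cong suc (length-filter+filter-∁ xs)
  ... | false = trans (+-suc _ _) (cong suc (length-filter+filter-∁ xs))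

  2*length-filter≤length : (f : A → A) (xs : List A) → Unique xs →
    (∀ {x} → x ∈ₗ xs → P x → f x ∈ₗ xs × ¬ P (f x)) →
    (∀ {x y} → x ∈ₗ xs → y ∈ₗ xs → P x → P y → f x ≡ f y → x ≡ y) →
    2 * length (filter P? xs) ≤ length xs
  2*length-filter≤length f xs xs! flips inj = begin
    2 * length (filter P? xs)                            ≡⟨ cong (length (filter P? xs) +_) (+-identityʳ _) ⟩
    length (filter P? xs) + length (filter P? xs)        ≤⟨ +-monoʳ-≤ (length (filter P? xs)) injection ⟩
    length (filter P? xs) + length (filter (∁? P?) xs)  ≡⟨ length-filter+filter-∁ xs ⟩
    length xs                                            ∎
    where
    open ≤-Reasoning
    injection : length (filter P? xs) ≤ length (filter (∁? P?) xs)
    injection = length-≤-injection f (filter P? xs) (filter (∁? P?) xs) (filter⁺ P? xs!)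
      (λ x∈ → let (x∈xs , px) = ∈-filter⁻ P? x∈ ; (fx∈xs , ¬pfx) = flips x∈xs px
              in ∈-filter⁺ (∁? P?) fx∈xs ¬pfx)
      (λ x∈ y∈ → let (x∈xs , px) = ∈-filter⁻ P? x∈ ; (y∈xs , py) = ∈-filter⁻ P? y∈
                 in inj x∈xs y∈xs px py)

-- Walks

module _ {A : Set} where

  splice : ℕ → (ℕ → A) → (ℕ → A) → ℕ → A
  splice i f g k with k ≤? i
  ... | yes _ = f k
  ... | no  _ = g k

  splice-≤ : ∀ {i f g k} → k ≤ i → splice i f g k ≡ f k
  splice-≤ {i} {k = k} k≤i with k ≤? i
  ... | yes _   = refl
  ... | no  k≰i = ⊥-elim (k≰i k≤i)

  splice-> : ∀ {i f g k} → i < k → splice i f g k ≡ g k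
  splice-> {i} {k = k} i<k with k ≤? i
  ... | yes k≤i = ⊥-elim (<⇒≱ i<k k≤i)
  ... | no  _   = refl

suc[m∸1+k]≡m∸k : ∀ {m k} → k < m → suc (m ∸ suc k) ≡ m ∸ k
suc[m∸1+k]≡m∸k {suc m} {zero}  _         = refl
suc[m∸1+k]≡m∸k {suc m} {suc k} (s≤s k<m) = suc[m∸1+k]≡m∸k k<m

neighbouring : ∀ {i j} → i ≢ j → ¬ suc i < j → ¬ suc j < i → suc i ≡ j ⊎ suc j ≡ i
neighbouring {i} {j} i≢j i+1≮j j+1≮i with <-cmp i j
... | tri< i<j _ _ = inj₁ (≤∧≮⇒≡ i<j i+1≮j)
... | tri≈ _ i≡j _ = contradiction i≡j i≢j
... | tri> _ _ j<i = inj₂ (≤∧≮⇒≡ j<i j+1≮i)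

module Adjacency {n} (G : Graph n) where

  infix 4 _~_
  _~_ : Fin n → Fin n → Set
  _~_ = Adj G

  adj⇒≢ : ∀ {x y} → x ~ y → x ≢ y
  adj⇒≢ x~x refl = irrefl G x~x

  adj-separates : ∀ {x y z} → z ~ x → ¬ z ~ y → x ≢ y
  adj-separates z~x z≁y refl = z≁y z~x

module Walks {n} (G : Graph n) where

  open Adjacency G public

  -- `at` is unconstrained beyond m.
  record Walk (P : Pred (Fin n) 0ℓ) (a b : Fin n) (m : ℕ) : Set where
    constructor walk
    field
      at     : ℕ → Fin n
      at-0   : at 0 ≡ a
      at-end : at m ≡ b
      step   : ∀ k → k < m → at k ~ at (suc k)
      inner  : ∀ k → 0 < k → k < m → P (at k)
  open Walk public

  module _ {P : Pred (Fin n) 0ℓ} where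

    nil : ∀ {a} → Walk P a a 0
    nil {a} = walk (λ _ → a) refl refl (λ _ ()) (λ _ _ ())

    edge : ∀ {a b} → a ~ b → Walk P a b 1
    edge {a} {b} a~b = walk (λ { zero → a ; (suc _) → b }) refl refl
      (λ { zero _ → a~b ; (suc _) (s≤s ()) }) (λ { zero () _ ; (suc _) _ (s≤s ()) })

    reverse : ∀ {a b m} → Walk P a b m → Walk P b a m
    reverse {a} {b} {m} w = walk (λ k → at w (m ∸ k)) (at-end w)
      (trans (cong (at w) (n∸n≡0 m)) (at-0 w)) step′ inner′
      where
      step′ : ∀ k → k < m → at w (m ∸ k) ~ at w (m ∸ suc k)
      step′ k k<m = symm G (subst (λ j → at w (m ∸ suc k) ~ at w j) (suc[m∸1+k]≡m∸k k<m)
        (step w (m ∸ suc k) (∸-monoʳ-< z<s k<m)))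
      inner′ : ∀ k → 0 < k → k < m → P (at w (m ∸ k))
      inner′ k 0<k k<m = inner w (m ∸ k) (m<n⇒0<n∸m k<m) (∸-monoʳ-< 0<k (<⇒≤ k<m))

    infixr 5 _++⟨_⟩_
    _++⟨_⟩_ : ∀ {a b c m₁ m₂} → Walk P a b m₁ → P b → Walk P b c m₂ → Walk P a c (m₁ + m₂)
    _++⟨_⟩_ {a} {b} {c} {m₁} {m₂} w₁ pb w₂ = walk v v-0 v-end step′ inner′
      where
      v : ℕ → Fin n
      v = splice m₁ (at w₁) (λ k → at w₂ (k ∸ m₁))
      v-first : ∀ {k} → k ≤ m₁ → v k ≡ at w₁ k
      v-first = splice-≤ {f = at w₁}
      v-second : ∀ {k} → m₁ ≤ k → v k ≡ at w₂ (k ∸ m₁)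
      v-second m₁≤k with m≤n⇒m<n∨m≡n m₁≤k
      ... | inj₁ m₁<k  = splice-> {f = at w₁} m₁<k
      ... | inj₂ refl  = trans (v-first ≤-refl)
        (trans (at-end w₁) (trans (sym (at-0 w₂)) (cong (at w₂) (sym (n∸n≡0 m₁)))))
      v-0 : v 0 ≡ a
      v-0 = trans (v-first z≤n) (at-0 w₁)
      v-end : v (m₁ + m₂) ≡ c
      v-end = trans (v-second (m≤m+n m₁ m₂)) (trans (cong (at w₂) (m+n∸m≡n m₁ m₂)) (at-end w₂))
      shifted : ∀ {k} → m₁ ≤ k → k < m₁ + m₂ → k ∸ m₁ < m₂
      shifted {k} m₁≤k k<m =
        +-cancelˡ-< m₁ (k ∸ m₁) m₂ (subst (_< m₁ + m₂) (sym (m+[n∸m]≡n m₁≤k)) k<m)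
      step′ : ∀ k → k < m₁ + m₂ → v k ~ v (suc k)
      step′ k k<m with m₁ ≤? k
      ... | no  k≱m₁ = subst₂ _~_ (sym (v-first (<⇒≤ k<m₁))) (sym (v-first k<m₁)) (step w₁ k k<m₁)
        where k<m₁ = ≰⇒> k≱m₁
      ... | yes m₁≤k = subst₂ _~_ (sym (v-second m₁≤k)) (sym (v-second (m≤n⇒m≤1+n m₁≤k)))
          (subst (λ j → at w₂ (k ∸ m₁) ~ at w₂ j) (sym (+-∸-assoc 1 m₁≤k))
            (step w₂ (k ∸ m₁) (shifted m₁≤k k<m)))
      inner′ : ∀ k → 0 < k → k < m₁ + m₂ → P (v k)
      inner′ k 0<k k<m with <-cmp k m₁
      ... | tri< k<m₁ _ _ = subst P (sym (v-first (<⇒≤ k<m₁))) (inner w₁ k 0<k k<m₁)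
      ... | tri≈ _ refl _ = subst P (sym (trans (v-first ≤-refl) (at-end w₁))) pb
      ... | tri> _ _ m₁<k = subst P (sym (splice-> {f = at w₁} m₁<k))
          (inner w₂ (k ∸ m₁) (m<n⇒0<n∸m m₁<k) (shifted (<⇒≤ m₁<k) k<m))

    shortcut : ∀ {a b m m′ d i} (w : Walk P a b m) → m ≡ m′ + d → i < m′ →
               at w i ~ at w (suc i + d) → Walk P a b m′
    shortcut {a} {b} {_} {m} {d} {i} w refl i<m chord = walk v v-0 v-end step′ inner′
      where
      v : ℕ → Fin n
      v = splice i (at w) (λ k → at w (k + d))
      v-first : ∀ {k} → k ≤ i → v k ≡ at w k
      v-first = splice-≤ {f = at w}
      v-second : ∀ {k} → i < k → v k ≡ at w (k + d)
      v-second = splice-> {f = at w}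
      v-0 : v 0 ≡ a
      v-0 = trans (v-first z≤n) (at-0 w)
      v-end : v m ≡ b
      v-end = trans (v-second i<m) (at-end w)
      below : ∀ {k} → k < m → k < m + d
      below k<m = ≤-trans k<m (m≤m+n _ d)
      step′ : ∀ k → k < m → v k ~ v (suc k)
      step′ k k<m with <-cmp k i
      ... | tri< k<i _ _ = subst₂ _~_ (sym (v-first (<⇒≤ k<i))) (sym (v-first k<i)) (step w k (below k<m))
      ... | tri≈ _ refl _ = subst₂ _~_ (sym (v-first ≤-refl)) (sym (v-second ≤-refl)) chord
      ... | tri> _ _ i<k = subst₂ _~_ (sym (v-second i<k)) (sym (v-second (m<n⇒m<1+n i<k)))
          (step w (k + d) (+-monoˡ-< d k<m))
      inner′ : ∀ k → 0 < k → k < m → P (v k)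
      inner′ k 0<k k<m with i <? k
      ... | no  k≤i = subst P (sym (v-first (≮⇒≥ k≤i))) (inner w k 0<k (below k<m))
      ... | yes i<k = subst P (sym (v-second i<k))
          (inner w (k + d) (≤-trans 0<k (m≤m+n k d)) (+-monoˡ-< d k<m))

    truncate : ∀ {a b m j} (w : Walk P a b m) → j < m → at w j ≡ b → Walk P a b j
    truncate w j<m at-j = walk (at w) (at-0 w) at-j
      (λ k k<j → step w k (<-trans k<j j<m)) (λ k 0<k k<j → inner w k 0<k (<-trans k<j j<m))

  record InducedWalk (P : Pred (Fin n) 0ℓ) (a b : Fin n) (m : ℕ) : Set where
    field
      toWalk    : Walk P a b m
      distinct  : ∀ {i j} → i < j → j ≤ m → at toWalk i ≢ at toWalk j
      chordless : ∀ {i j} → suc i < j → j ≤ m → ¬ at toWalk i ~ at toWalk j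
  open InducedWalk public

  module _ {P : Pred (Fin n) 0ℓ} {a b m} (w : Walk P a b m)
           (shortest : ∀ {k} → k < m → ¬ Walk P a b k) where

    shortest⇒chordless : ∀ {i j} → suc i < j → j ≤ m → ¬ at w i ~ at w j
    shortest⇒chordless {i} {j} i+1<j j≤m chord =
      shortest (∸-monoʳ-< (m<n⇒0<n∸m i+1<j) d≤m) (shortcut w m≡ i<m-d chord′)
      where
      d = j ∸ suc i
      d≤m : d ≤ m
      d≤m = ≤-trans (m∸n≤m j (suc i)) j≤m
      m≡ : m ≡ (m ∸ d) + d
      m≡ = sym (m∸n+n≡m d≤m)
      j≡ : suc i + d ≡ j
      j≡ = m+[n∸m]≡n (<⇒≤ i+1<j)
      i<m-d : i < m ∸ d
      i<m-d = +-cancelʳ-≤ d (suc i) (m ∸ d) (subst (suc i + d ≤_) m≡ (subst (_≤ m) (sym j≡) j≤m))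
      chord′ : at w i ~ at w (suc i + d)
      chord′ = subst (λ k → at w i ~ at w k) (sym j≡) chord

    shortest⇒distinct : ∀ {i j} → i < j → j ≤ m → at w i ≢ at w j
    shortest⇒distinct {i} {j} i<j j≤m wi≡wj with m≤n⇒m<n∨m≡n j≤m
    ... | inj₂ refl = shortest i<j (truncate w i<j (trans wi≡wj (at-end w)))
    ... | inj₁ j<m  = shortest⇒chordless (s≤s i<j) j<m
      (subst (λ x → x ~ at w (suc j)) (sym wi≡wj) (step w j j<m))

  ¬¬-induced : ∀ {P a b m} → Walk P a b m → DoubleNegation (∃ (InducedWalk P a b))
  ¬¬-induced {P} {a} {b} {m} w = do
    (m₀ , w₀ , shortest) ← ¬¬-least {Walk P a b} m w
    pure (m₀ , record { toWalk    = w₀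
                      ; distinct  = shortest⇒distinct w₀ shortest
                      ; chordless = shortest⇒chordless w₀ shortest })

-- Chordless cycles

module Bipartite {n} (G : Graph n) (side : Fin n → Bool) (bip : IsBipartition G side) where

  open Adjacency G

  adj-leaves : ∀ {b x y} → x ~ y → side x ≡ b → side y ≢ b
  adj-leaves {x = x} {y} x~y sx≡b sy≡b = bip x y x~y (trans sx≡b (sym sy≡b))

  adj-enters : ∀ {b x y} → x ~ y → side x ≢ b → side y ≡ b
  adj-enters {x = x} {y} x~y sx≢b =
    trans (¬-not (λ e → bip x y x~y (sym e))) (sym (¬-not (λ e → sx≢b (sym e))))


module ChordalBipartiteCycles {n} (G : Graph n) (side : Fin n → Bool) (bip : IsBipartition G side)
  (chordal : ∀ k → 6 ≤ k → (C : Cycle G k) → HasChord C) where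

  open Walks G
  open Bipartite G side bip

  Next : ℕ → ℕ → ℕ → Set
  Next k i j = suc i ≡ j ⊎ (suc i ≡ k × j ≡ 0)

  -- The cycle is v 0, v 1, …, v k, back to v 0; it has length k + 1.
  no-chordless-cycle : ∀ {k} → 5 ≤ k → (v : ℕ → Fin n) →
    (∀ i j → i ≤ k → j ≤ k → v i ≡ v j → i ≡ j) →
    (∀ i → i < k → v i ~ v (suc i)) → v k ~ v 0 →
    (∀ i j → i ≤ k → j ≤ k → v i ~ v j → Next (suc k) i j ⊎ Next (suc k) j i) → ⊥
  no-chordless-cycle {k} 5≤k v injective steps closing consecutive =
    no-chord (chordal (suc k) (s≤s 5≤k) cycle)
    where
    bound : (i : Fin (suc k)) → toℕ i ≤ k
    bound i = ≤-pred (toℕ<n i)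
    edges′ : ∀ i j → CycNext i j → v (toℕ i) ~ v (toℕ j)
    edges′ i j (inj₁ i+1≡j)      = subst (λ l → v (toℕ i) ~ v l) i+1≡j
      (steps (toℕ i) (subst (_≤ k) (sym i+1≡j) (bound j)))
    edges′ i j (inj₂ (i+1≡k+1 , j≡0)) rewrite suc-injective i+1≡k+1 | j≡0 = closing
    cycle : Cycle G (suc k)
    cycle = record
      { len≥3 = ≤-trans (s≤s (s≤s (s≤s z≤n))) (s≤s 5≤k)
      ; vert  = λ i → v (toℕ i)
      ; inj   = λ {i} {j} e → toℕ-injective (injective (toℕ i) (toℕ j) (bound i) (bound j) e)
      ; edges = edges′
      }
    no-chord : HasChord cycle → ⊥
    no-chord (i , j , vi~vj , ¬next-ij , ¬next-ji)
      with consecutive (toℕ i) (toℕ j) (bound i) (bound j) vi~vj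
    ... | inj₁ next-ij = ¬next-ij next-ij
    ... | inj₂ next-ji = ¬next-ji next-ji

  no-induced-hexagon : ∀ {v₀ v₁ v₂ v₃ v₄ v₅} →
    v₀ ~ v₁ → v₁ ~ v₂ → v₂ ~ v₃ → v₃ ~ v₄ → v₄ ~ v₅ → v₅ ~ v₀ →
    ¬ v₀ ~ v₃ → ¬ v₁ ~ v₄ → ¬ v₂ ~ v₅ → ⊥
  no-induced-hexagon {v₀} {v₁} {v₂} {v₃} {v₄} {v₅} a₀₁ a₁₂ a₂₃ a₃₄ a₄₅ a₅₀ ¬a₀₃ ¬a₁₄ ¬a₂₅ =
    no-chordless-cycle ≤-refl v injective steps a₅₀ consecutive
    where
    v : ℕ → Fin n
    v 0 = v₀
    v 1 = v₁
    v 2 = v₂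
    v 3 = v₃
    v 4 = v₄
    v _ = v₅
    b = side v₀
    s₁ : side v₁ ≢ b
    s₁ = adj-leaves a₀₁ refl
    s₂ : side v₂ ≡ b
    s₂ = adj-enters a₁₂ s₁
    s₃ : side v₃ ≢ b
    s₃ = adj-leaves a₂₃ s₂
    s₄ : side v₄ ≡ b
    s₄ = adj-enters a₃₄ s₃
    s₅ : side v₅ ≢ b
    s₅ = adj-leaves a₄₅ s₄
    apart : ∀ {x y} → side x ≡ b → side y ≢ b → x ≢ y
    apart sx sy refl = sy sx
    even : ∀ {x y} → side x ≡ b → side y ≡ b → ¬ x ~ y
    even sx sy x~y = adj-leaves x~y sx sy
    odd : ∀ {x y} → side x ≢ b → side y ≢ b → ¬ x ~ y
    odd sx sy x~y = sy (adj-enters x~y sx)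
    ≢₀₂ : v₀ ≢ v₂
    ≢₀₂ = adj-separates a₅₀ (¬a₂₅ ∘ symm G)
    ≢₀₄ : v₀ ≢ v₄
    ≢₀₄ = adj-separates (symm G a₀₁) ¬a₁₄
    ≢₂₄ : v₂ ≢ v₄
    ≢₂₄ = adj-separates a₁₂ ¬a₁₄
    ≢₁₃ : v₁ ≢ v₃
    ≢₁₃ = adj-separates a₀₁ ¬a₀₃
    ≢₁₅ : v₁ ≢ v₅
    ≢₁₅ = adj-separates (symm G a₁₂) ¬a₂₅
    ≢₃₅ : v₃ ≢ v₅
    ≢₃₅ = adj-separates a₂₃ ¬a₂₅
    steps : ∀ i → i < 5 → v i ~ v (suc i)
    steps 0 _ = a₀₁
    steps 1 _ = a₁₂
    steps 2 _ = a₂₃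
    steps 3 _ = a₃₄
    steps 4 _ = a₄₅
    steps (suc (suc (suc (suc (suc _))))) (s≤s (s≤s (s≤s (s≤s (s≤s ())))))
    injective : ∀ i j → i ≤ 5 → j ≤ 5 → v i ≡ v j → i ≡ j
    injective 0 0 _ _ _ = refl
    injective 0 1 _ _ e = contradiction e (apart refl s₁)
    injective 0 2 _ _ e = contradiction e ≢₀₂
    injective 0 3 _ _ e = contradiction e (apart refl s₃)
    injective 0 4 _ _ e = contradiction e ≢₀₄
    injective 0 5 _ _ e = contradiction e (apart refl s₅)
    injective 1 0 _ _ e = contradiction (sym e) (apart refl s₁)
    injective 1 1 _ _ _ = refl
    injective 1 2 _ _ e = contradiction (sym e) (apart s₂ s₁)
    injective 1 3 _ _ e = contradiction e ≢₁₃
    injective 1 4 _ _ e = contradiction (sym e) (apart s₄ s₁)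
    injective 1 5 _ _ e = contradiction e ≢₁₅
    injective 2 0 _ _ e = contradiction (sym e) ≢₀₂
    injective 2 1 _ _ e = contradiction e (apart s₂ s₁)
    injective 2 2 _ _ _ = refl
    injective 2 3 _ _ e = contradiction e (apart s₂ s₃)
    injective 2 4 _ _ e = contradiction e ≢₂₄
    injective 2 5 _ _ e = contradiction e (apart s₂ s₅)
    injective 3 0 _ _ e = contradiction (sym e) (apart refl s₃)
    injective 3 1 _ _ e = contradiction (sym e) ≢₁₃
    injective 3 2 _ _ e = contradiction (sym e) (apart s₂ s₃)
    injective 3 3 _ _ _ = refl
    injective 3 4 _ _ e = contradiction (sym e) (apart s₄ s₃)
    injective 3 5 _ _ e = contradiction e ≢₃₅
    injective 4 0 _ _ e = contradiction (sym e) ≢₀₄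
    injective 4 1 _ _ e = contradiction e (apart s₄ s₁)
    injective 4 2 _ _ e = contradiction (sym e) ≢₂₄
    injective 4 3 _ _ e = contradiction e (apart s₄ s₃)
    injective 4 4 _ _ _ = refl
    injective 4 5 _ _ e = contradiction e (apart s₄ s₅)
    injective 5 0 _ _ e = contradiction (sym e) (apart refl s₅)
    injective 5 1 _ _ e = contradiction (sym e) ≢₁₅
    injective 5 2 _ _ e = contradiction (sym e) (apart s₂ s₅)
    injective 5 3 _ _ e = contradiction (sym e) ≢₃₅
    injective 5 4 _ _ e = contradiction (sym e) (apart s₄ s₅)
    injective 5 5 _ _ _ = refl
    injective (suc (suc (suc (suc (suc (suc _)))))) _ (s≤s (s≤s (s≤s (s≤s (s≤s ()))))) _ _
    injective _ (suc (suc (suc (suc (suc (suc _)))))) _ (s≤s (s≤s (s≤s (s≤s (s≤s ()))))) _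
    consecutive : ∀ i j → i ≤ 5 → j ≤ 5 → v i ~ v j → Next 6 i j ⊎ Next 6 j i
    consecutive 0 0 _ _ a = contradiction a (even refl refl)
    consecutive 0 1 _ _ _ = inj₁ (inj₁ refl)
    consecutive 0 2 _ _ a = contradiction a (even refl s₂)
    consecutive 0 3 _ _ a = contradiction a ¬a₀₃
    consecutive 0 4 _ _ a = contradiction a (even refl s₄)
    consecutive 0 5 _ _ _ = inj₂ (inj₂ (refl , refl))
    consecutive 1 0 _ _ _ = inj₂ (inj₁ refl)
    consecutive 1 1 _ _ a = contradiction a (odd s₁ s₁)
    consecutive 1 2 _ _ _ = inj₁ (inj₁ refl)
    consecutive 1 3 _ _ a = contradiction a (odd s₁ s₃)
    consecutive 1 4 _ _ a = contradiction a ¬a₁₄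
    consecutive 1 5 _ _ a = contradiction a (odd s₁ s₅)
    consecutive 2 0 _ _ a = contradiction a (even s₂ refl)
    consecutive 2 1 _ _ _ = inj₂ (inj₁ refl)
    consecutive 2 2 _ _ a = contradiction a (even s₂ s₂)
    consecutive 2 3 _ _ _ = inj₁ (inj₁ refl)
    consecutive 2 4 _ _ a = contradiction a (even s₂ s₄)
    consecutive 2 5 _ _ a = contradiction a ¬a₂₅
    consecutive 3 0 _ _ a = contradiction (symm G a) ¬a₀₃
    consecutive 3 1 _ _ a = contradiction a (odd s₃ s₁)
    consecutive 3 2 _ _ _ = inj₂ (inj₁ refl)
    consecutive 3 3 _ _ a = contradiction a (odd s₃ s₃)
    consecutive 3 4 _ _ _ = inj₁ (inj₁ refl)
    consecutive 3 5 _ _ a = contradiction a (odd s₃ s₅)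
    consecutive 4 0 _ _ a = contradiction a (even s₄ refl)
    consecutive 4 1 _ _ a = contradiction (symm G a) ¬a₁₄
    consecutive 4 2 _ _ a = contradiction a (even s₄ s₂)
    consecutive 4 3 _ _ _ = inj₂ (inj₁ refl)
    consecutive 4 4 _ _ a = contradiction a (even s₄ s₄)
    consecutive 4 5 _ _ _ = inj₁ (inj₁ refl)
    consecutive 5 0 _ _ _ = inj₁ (inj₂ (refl , refl))
    consecutive 5 1 _ _ a = contradiction a (odd s₅ s₁)
    consecutive 5 2 _ _ a = contradiction (symm G a) ¬a₂₅
    consecutive 5 3 _ _ a = contradiction a (odd s₅ s₃)
    consecutive 5 4 _ _ _ = inj₂ (inj₁ refl)
    consecutive 5 5 _ _ a = contradiction a (odd s₅ s₅)
    consecutive (suc (suc (suc (suc (suc (suc _)))))) _ (s≤s (s≤s (s≤s (s≤s (s≤s ()))))) _ _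
    consecutive _ (suc (suc (suc (suc (suc (suc _)))))) _ (s≤s (s≤s (s≤s (s≤s (s≤s ()))))) _

  -- An induced path of length ≥ 4 and an apex z seeing only its ends form a chordless cycle of length ≥ 6.
  no-chordless-closure : ∀ {P s t m} (p : InducedWalk P s t m) {z} → 4 ≤ m →
    z ~ s → z ~ t → (∀ k → 0 < k → k < m → ¬ z ~ at (toWalk p) k) →
    (∀ k → k ≤ m → z ≢ at (toWalk p) k) → ⊥
  no-chordless-closure {P} {s} {t} {m} p {z} 4≤m z~s z~t z≁inner z∉p =
    no-chordless-cycle (s≤s 4≤m) v injective steps closing consecutive
    where
    w = toWalk p
    v : ℕ → Fin n
    v zero    = z
    v (suc k) = at w k
    injective : ∀ i j → i ≤ suc m → j ≤ suc m → v i ≡ v j → i ≡ j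
    injective zero    zero    _         _         _ = refl
    injective zero    (suc j) _         (s≤s j≤m) e = contradiction e (z∉p j j≤m)
    injective (suc i) zero    (s≤s i≤m) _         e = contradiction (sym e) (z∉p i i≤m)
    injective (suc i) (suc j) (s≤s i≤m) (s≤s j≤m) e with <-cmp i j
    ... | tri< i<j _ _ = contradiction e (distinct p i<j j≤m)
    ... | tri≈ _ i≡j _ = cong suc i≡j
    ... | tri> _ _ j<i = contradiction (sym e) (distinct p j<i i≤m)
    steps : ∀ i → i < suc m → v i ~ v (suc i)
    steps zero    _         = subst (z ~_) (sym (at-0 w)) z~s
    steps (suc i) (s≤s i<m) = step w i i<m
    closing : v (suc m) ~ v 0
    closing = symm G (subst (z ~_) (sym (at-end w)) z~t)
    consecutive : ∀ i j → i ≤ suc m → j ≤ suc m → v i ~ v j →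
                  Next (suc (suc m)) i j ⊎ Next (suc (suc m)) j i
    consecutive zero zero _ _ a = contradiction a (irrefl G)
    consecutive zero (suc zero) _ _ _ = inj₁ (inj₁ refl)
    consecutive zero (suc (suc j)) _ (s≤s j≤m) a with m≤n⇒m<n∨m≡n j≤m
    ... | inj₁ j<m  = contradiction a (z≁inner (suc j) z<s j<m)
    ... | inj₂ refl = inj₂ (inj₂ (refl , refl))
    consecutive (suc zero) zero _ _ _ = inj₂ (inj₁ refl)
    consecutive (suc (suc i)) zero (s≤s i≤m) _ a with m≤n⇒m<n∨m≡n i≤m
    ... | inj₁ i<m  = contradiction (symm G a) (z≁inner (suc i) z<s i<m)
    ... | inj₂ refl = inj₁ (inj₂ (refl , refl))
    consecutive (suc i) (suc j) (s≤s i≤m) (s≤s j≤m) a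
      with neighbouring (adj⇒≢ a ∘ cong (at w)) (λ i+1<j → chordless p i+1<j j≤m a)
             (λ j+1<i → chordless p j+1<i i≤m (symm G a))
    ... | inj₁ i+1≡j = inj₁ (inj₁ (cong suc i+1≡j))
    ... | inj₂ j+1≡i = inj₂ (inj₁ (cong suc j+1≡i))

-- Maximum neighbours in chordal bipartite graphs

module _ {n} {P : Pred (Fin n) 0ℓ} (P? : Decidable P) where

  subset : Subset n
  subset = tabulate (λ x → does (P? x))

  ∈-subset⁺ : ∀ {x} → P x → x ∈ subset
  ∈-subset⁺ {x} px = lookup⇒[]= x subset (trans (lookup∘tabulate _ x) (dec-true (P? x) px))

  ∈-subset⁻ : ∀ {x} → x ∈ subset → P x
  ∈-subset⁻ {x} x∈ = witness (P? x) (trans (sym (lookup∘tabulate _ x)) ([]=⇒lookup x∈))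
    where
    witness : (d : Dec (P x)) → does d ≡ true → P x
    witness (yes px) _ = px

MaxNeighbourIn : ∀ {n} → Graph n → Subset n → Fin n → Fin n → Set
MaxNeighbourIn G Z w u =
  u ∈ Z × Adj G w u × (∀ {v t} → v ∈ Z → t ∈ Z → Adj G w v → Adj G v t → Adj G u t)

module MaximumNeighbours {n} (G : Graph n) (side : Fin n → Bool) (bip : IsBipartition G side)
  (chordal : ∀ k → 6 ≤ k → (C : Cycle G k) → HasChord C) (adj? : ∀ x y → Dec (Adj G x y))
  (b : Bool) where

  open Walks G
  open Bipartite G side bip
  open ChordalBipartiteCycles G side bip chordal

  HasMaxNeighbourIn : Subset n → Fin n → Set
  HasMaxNeighbourIn Z w = w ∈ Z × side w ≡ b × ∃ (MaxNeighbourIn G Z w)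

  -- Strengthened for the induction on X: the vertex can be found away from any given u₀,
  -- as in Dirac's lemma on two nonadjacent simplicial vertices.
  Claim : Subset n → Set
  Claim X = ∀ {u₀ w₀ y₀} → u₀ ∈ X → side u₀ ≢ b → w₀ ∈ X → side w₀ ≡ b → y₀ ∈ X → w₀ ~ y₀ →
            ¬ u₀ ~ w₀ → DoubleNegation (∃ λ w → HasMaxNeighbourIn X w × ¬ u₀ ~ w)

  HasMaxNeighbourIn-lift : ∀ {Z X w} → Z ⊆ X →
    (∀ {v t} → v ∈ X → t ∈ X → w ~ v → v ~ t → v ∈ Z × t ∈ Z) →
    HasMaxNeighbourIn Z w → HasMaxNeighbourIn X w
  HasMaxNeighbourIn-lift Z⊆X closed (w∈Z , w∈b , u , u∈Z , w~u , max) =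
    Z⊆X w∈Z , w∈b , u , Z⊆X u∈Z , w~u ,
    λ v∈X t∈X w~v v~t → let (v∈Z , t∈Z) = closed v∈X t∈X w~v v~t in max v∈Z t∈Z w~v v~t

  Undominated : Subset n → Fin n → Fin n → Set
  Undominated Z c t = t ∈ Z × side t ≡ b × (∃ λ v → v ∈ Z × t ~ v) × ¬ c ~ t

  -- A vertex c adjacent to every non-isolated vertex of Z on side b is a maximum neighbour of each of them.
  ¬¬-avoiding-or-dominated : ∀ {Z c w y} → Claim Z → c ∈ Z → side c ≢ b →
    w ∈ Z → side w ≡ b → y ∈ Z → w ~ y →
    DoubleNegation ((∃ λ w′ → HasMaxNeighbourIn Z w′ × ¬ c ~ w′) ⊎ HasMaxNeighbourIn Z w)
  ¬¬-avoiding-or-dominated {Z} {c} {w} {y} claim c∈Z c∉b w∈Z w∈b y∈Z w~y = do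
    no ¬undominated ← ¬¬-excluded-middle {A = ∃ (Undominated Z c)}
      where yes (t , t∈Z , t∈b , (v , v∈Z , t~v) , c≁t) →
              inj₁ <$> claim c∈Z c∉b t∈Z t∈b v∈Z t~v c≁t
    let dominates : ∀ {t v} → t ∈ Z → side t ≡ b → v ∈ Z → t ~ v → c ~ t
        dominates {t} t∈Z t∈b v∈Z t~v =
          decidable-stable (adj? c t) (λ c≁t → ¬undominated (_ , t∈Z , t∈b , (_ , v∈Z , t~v) , c≁t))
    pure (inj₂ (w∈Z , w∈b , c , c∈Z , symm G (dominates w∈Z w∈b y∈Z w~y) ,
      λ {_} {_} v∈Z t∈Z w~v v~t → dominates t∈Z (adj-enters v~t (adj-leaves w~v w∈b)) v∈Z (symm G v~t)))

  module Step (X : Subset n) (ih : ∀ {Y} → Y ⊂ X → Claim Y)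
    {u₀ w₀ y₀} (u₀∈X : u₀ ∈ X) (u₀∉b : side u₀ ≢ b) (w₀∈X : w₀ ∈ X) (w₀∈b : side w₀ ≡ b)
    (y₀∈X : y₀ ∈ X) (w₀~y₀ : w₀ ~ y₀) (u₀≁w₀ : ¬ u₀ ~ w₀) where

    Far : Fin n → Set
    Far x = x ∈ X × ¬ u₀ ~ x × x ≢ u₀

    -- The component of w₀ in G[X ∖ N[u₀]].
    data Reach : Fin n → Set where
      start  : Reach w₀
      extend : ∀ {x y} → Reach x → x ~ y → Far y → Reach y

    Attached : Fin n → Set
    Attached s = s ∈ X × u₀ ~ s × ∃ λ r → Reach r × s ~ r

    CommonNeighbour : List (Fin n) → Set
    CommonNeighbour L = ∃ λ c → Reach c × side c ≢ b × All (c ~_) L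

    far-≁ : ∀ {x} → Far x → ¬ u₀ ~ x
    far-≁ = proj₁ ∘ proj₂

    far-≢ : ∀ {x} → Far x → x ≢ u₀
    far-≢ = proj₂ ∘ proj₂

    far-in-b : ∀ {t} → t ∈ X → side t ≡ b → ¬ u₀ ~ t → Far t
    far-in-b t∈X t∈b u₀≁t = t∈X , u₀≁t , λ { refl → u₀∉b t∈b }

    far-neighbour : ∀ {w v} → side w ≡ b → ¬ u₀ ~ w → v ∈ X → w ~ v → Far v
    far-neighbour w∈b u₀≁w v∈X w~v =
      v∈X , (λ u₀~v → adj-leaves w~v w∈b (adj-enters u₀~v u₀∉b)) ,
      λ { refl → u₀≁w (symm G w~v) }

    reach⇒far : ∀ {x} → Reach x → Far x
    reach⇒far start              = far-in-b w₀∈X w₀∈b u₀≁w₀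
    reach⇒far (extend _ _ far-y) = far-y

    reach-neighbour : ∀ {w v} → Reach w → side w ≡ b → v ∈ X → w ~ v → Reach v
    reach-neighbour reach-w w∈b v∈X w~v =
      extend reach-w w~v (far-neighbour w∈b (far-≁ (reach⇒far reach-w)) v∈X w~v)

    reach-y₀ : Reach y₀
    reach-y₀ = reach-neighbour start w₀∈b y₀∈X w₀~y₀

    reach-walk : ∀ {x} → Reach x → ∃ (Walk Reach w₀ x)
    reach-walk start                = 0 , nil
    reach-walk (extend r x~y far-y) =
      let (m , w) = reach-walk r in m + 1 , w ++⟨ r ⟩ edge x~y

    attached-~ : ∀ {s} → Attached s → u₀ ~ s
    attached-~ = proj₁ ∘ proj₂

    attached⇒b : ∀ {s} → Attached s → side s ≡ b
    attached⇒b att = adj-enters (attached-~ att) u₀∉b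

    -- Any longer induced path would close, through u₀, to a chordless cycle of length ≥ 6.
    induced-path⇒common-neighbour : ∀ {s₁ s₂ m} → Attached s₁ → Attached s₂ → s₁ ≢ s₂ →
      InducedWalk Reach s₁ s₂ m → CommonNeighbour (s₁ ∷ s₂ ∷ [])
    induced-path⇒common-neighbour {s₁} {s₂} {m} att₁ att₂ s₁≢s₂ p = by-length m refl
      where
      w = toWalk p
      s₁∈b = attached⇒b att₁
      s₂∈b = attached⇒b att₂
      s₁~p₁ : 0 < m → s₁ ~ at w 1
      s₁~p₁ 0<m = subst (_~ at w 1) (at-0 w) (step w 0 0<m)
      by-length : ∀ k → k ≡ m → CommonNeighbour (s₁ ∷ s₂ ∷ [])
      by-length 0 refl = contradiction (trans (sym (at-0 w)) (at-end w)) s₁≢s₂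
      by-length 1 refl = ⊥-elim (adj-leaves (subst (s₁ ~_) (at-end w) (s₁~p₁ z<s)) s₁∈b s₂∈b)
      by-length 2 refl =
        at w 1 , inner w 1 z<s (s<s z<s) , adj-leaves (s₁~p₁ z<s) s₁∈b , symm G (s₁~p₁ z<s) ∷ p₁~s₂ ∷ []
        where p₁~s₂ = subst (at w 1 ~_) (at-end w) (step w 1 (s<s z<s))
      by-length 3 refl = ⊥-elim (adj-leaves p₂~s₂ p₂∈b s₂∈b)
        where
        p₂∈b = adj-enters (step w 1 (s<s z<s)) (adj-leaves (s₁~p₁ z<s) s₁∈b)
        p₂~s₂ = subst (at w 2 ~_) (at-end w) (step w 2 (s<s (s<s z<s)))
      by-length (suc (suc (suc (suc _)))) refl =
        ⊥-elim (no-chordless-closure p (s≤s (s≤s (s≤s (s≤s z≤n)))) (attached-~ att₁) (attached-~ att₂)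
                  (λ k 0<k k<m → far-≁ (reach⇒far (inner w k 0<k k<m))) u₀∉walk)
        where
        u₀∉walk : ∀ j → j ≤ m → u₀ ≢ at w j
        u₀∉walk zero _ u₀≡ = adj⇒≢ (attached-~ att₁) (trans u₀≡ (at-0 w))
        u₀∉walk (suc j) j<m u₀≡ with m≤n⇒m<n∨m≡n j<m
        ... | inj₁ j+1<m = far-≢ (reach⇒far (inner w (suc j) z<s j+1<m)) (sym u₀≡)
        ... | inj₂ refl  = adj⇒≢ (attached-~ att₂) (trans u₀≡ (at-end w))

    ¬¬-common-neighbour₂ : ∀ {s₁ s₂} → Attached s₁ → Attached s₂ →
      DoubleNegation (CommonNeighbour (s₁ ∷ s₂ ∷ []))
    ¬¬-common-neighbour₂ {s₁} {s₂}
      att₁@(_ , _ , r₁ , reach₁ , s₁~r₁) att₂@(_ , _ , r₂ , reach₂ , s₂~r₂) with s₁ Fin.≟ s₂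
    ... | yes refl = pure (r₁ , reach₁ , adj-leaves s₁~r₁ (attached⇒b att₁) , r₁~s₁ ∷ r₁~s₁ ∷ [])
      where r₁~s₁ = symm G s₁~r₁
    ... | no s₁≢s₂ = do
      (_ , p) ← ¬¬-induced (edge s₁~r₁ ++⟨ reach₁ ⟩ reverse (proj₂ (reach-walk reach₁)) ++⟨ start ⟩
                            proj₂ (reach-walk reach₂) ++⟨ reach₂ ⟩ edge (symm G s₂~r₂))
      pure (induced-path⇒common-neighbour att₁ att₂ s₁≢s₂ p)

    -- If neither a (for x, t, …) nor c (for y, t, …) serves all of x, y, t, …, then d (for x, y) does:
    -- otherwise a x d y c t would be an induced hexagon.
    ¬¬-common-neighbour⁺ : ∀ {x y L} → Attached x → Attached y → All Attached L →
      DoubleNegation (CommonNeighbour (x ∷ y ∷ L))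
    ¬¬-common-neighbour⁺ att-x att-y [] = ¬¬-common-neighbour₂ att-x att-y
    ¬¬-common-neighbour⁺ {x} {y} att-x att-y (att-t ∷ atts) = do
      (a , reach-a , a∉b , a~x ∷ a~t ∷ a~L) ← ¬¬-common-neighbour⁺ att-x att-t atts
      (c , reach-c , c∉b , c~y ∷ c~t ∷ c~L) ← ¬¬-common-neighbour⁺ att-y att-t atts
      (d , reach-d , d∉b , d~x ∷ d~y ∷ []) ← ¬¬-common-neighbour₂ att-x att-y
      no a≁y ← ¬¬-excluded-middle {A = a ~ y}
        where yes a~y → pure (a , reach-a , a∉b , a~x ∷ a~y ∷ a~t ∷ a~L)
      no c≁x ← ¬¬-excluded-middle {A = c ~ x}
        where yes c~x → pure (c , reach-c , c∉b , c~x ∷ c~y ∷ c~t ∷ c~L)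
      d~tL ← ¬¬-All (All.zipWith
        (λ (a~t′ , c~t′) d≁t′ → no-induced-hexagon a~x (symm G d~x) d~y (symm G c~y) c~t′ (symm G a~t′)
                                  a≁y (c≁x ∘ symm G) d≁t′)
        (a~t ∷ a~L , c~t ∷ c~L))
      pure (d , reach-d , d∉b , d~x ∷ d~y ∷ d~tL)

    ¬¬-common-neighbour : ∀ {L} → All Attached L → DoubleNegation (CommonNeighbour L)
    ¬¬-common-neighbour [] = pure (y₀ , reach-y₀ , adj-leaves w₀~y₀ w₀∈b , [])
    ¬¬-common-neighbour (att@(_ , _ , r , reach , s~r) ∷ []) =
      pure (r , reach , adj-leaves s~r (attached⇒b att) , symm G s~r ∷ [])
    ¬¬-common-neighbour (att-x ∷ att-y ∷ atts) = ¬¬-common-neighbour⁺ att-x att-y atts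

    Around : Fin n → Set
    Around x = Reach x ⊎ Attached x ⊎ x ≡ u₀

    Result : Set
    Result = ∃ λ w → HasMaxNeighbourIn X w × ¬ u₀ ~ w

    around⇒∈X : ∀ {x} → Around x → x ∈ X
    around⇒∈X (inj₁ reach)          = proj₁ (reach⇒far reach)
    around⇒∈X (inj₂ (inj₁ att))     = proj₁ att
    around⇒∈X (inj₂ (inj₂ refl))    = u₀∈X

    around⇒reach : ∀ {w} → Around w → side w ≡ b → ¬ u₀ ~ w → Reach w
    around⇒reach (inj₁ reach)              _   _    = reach
    around⇒reach (inj₂ (inj₁ (_ , u₀~w , _))) _ u₀≁w = contradiction u₀~w u₀≁w
    around⇒reach (inj₂ (inj₂ refl))        w∈b _    = contradiction w∈b u₀∉b

    around-closed : ∀ {w v t} → Reach w → side w ≡ b → v ∈ X → t ∈ X → w ~ v → v ~ t →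
                    Around v × Around t
    around-closed {t = t} reach-w w∈b v∈X t∈X w~v v~t = inj₁ reach-v , around-t (adj? u₀ t)
      where
      reach-v = reach-neighbour reach-w w∈b v∈X w~v
      t∈b = adj-enters v~t (adj-leaves w~v w∈b)
      around-t : Dec (u₀ ~ t) → Around t
      around-t (yes u₀~t) = inj₂ (inj₁ (t∈X , u₀~t , _ , reach-v , symm G v~t))
      around-t (no u₀≁t)  = inj₁ (extend reach-v v~t (far-in-b t∈X t∈b u₀≁t))

    X′? : Decidable (λ x → x ∈ X × x ≢ u₀)
    X′? x = (x ∈? X) ×-dec ¬? (x Fin.≟ u₀)

    X′⊂X : subset X′? ⊂ X
    X′⊂X = proj₁ ∘ ∈-subset⁻ X′? , u₀ , u₀∈X , λ u₀∈X′ → proj₂ (∈-subset⁻ X′? u₀∈X′) refl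

    far⇒∈X′ : ∀ {x} → Far x → x ∈ subset X′?
    far⇒∈X′ (x∈X , _ , x≢u₀) = ∈-subset⁺ X′? (x∈X , x≢u₀)

    HasMaxNeighbourIn-X′⇒X : ∀ {w} → ¬ u₀ ~ w →
                             HasMaxNeighbourIn (subset X′?) w → HasMaxNeighbourIn X w
    HasMaxNeighbourIn-X′⇒X u₀≁w has@(_ , w∈b , _) =
      HasMaxNeighbourIn-lift (proj₁ X′⊂X) closed has
      where
      closed : ∀ {v t} → v ∈ X → t ∈ X → _ ~ v → v ~ t → v ∈ subset X′? × t ∈ subset X′?
      closed v∈X t∈X w~v v~t =
        ∈-subset⁺ X′? (v∈X , λ { refl → u₀≁w (symm G w~v) }) ,
        ∈-subset⁺ X′? (t∈X , λ { refl → u₀∉b (adj-enters v~t (adj-leaves w~v w∈b)) })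

    -- c dominates N(u₀) ∩ X, so recursing on X ∖ {u₀} with c in place of u₀
    -- finds a vertex that also misses u₀.
    ¬¬-result-dominating : ∀ {c} → Reach c → side c ≢ b → (∀ {s} → s ∈ X → u₀ ~ s → c ~ s) →
                           DoubleNegation Result
    ¬¬-result-dominating reach-c c∉b dominates = do
      inj₁ (w , has , c≁w) ← ¬¬-avoiding-or-dominated (ih X′⊂X) (far⇒∈X′ (reach⇒far reach-c)) c∉b
          (far⇒∈X′ (reach⇒far start)) w₀∈b (far⇒∈X′ (reach⇒far reach-y₀)) w₀~y₀
        where inj₂ has → pure (w₀ , HasMaxNeighbourIn-X′⇒X u₀≁w₀ has , u₀≁w₀)
      let u₀≁w = λ u₀~w → c≁w (dominates (proj₁ X′⊂X (proj₁ has)) u₀~w)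
      pure (w , HasMaxNeighbourIn-X′⇒X u₀≁w has , u₀≁w)

    module _ (around? : Decidable Around) where

      private Y = subset around?

      Y⊆X : Y ⊆ X
      Y⊆X = around⇒∈X ∘ ∈-subset⁻ around?

      ¬¬-result-proper : ∀ {x} → x ∈ X → x ∉ Y → DoubleNegation Result
      ¬¬-result-proper x∈X x∉Y = do
        (w , has@(w∈Y , w∈b , _) , u₀≁w) ← ih (Y⊆X , _ , x∈X , x∉Y)
          (∈-subset⁺ around? (inj₂ (inj₂ refl))) u₀∉b (∈-subset⁺ around? (inj₁ start)) w₀∈b
          (∈-subset⁺ around? (inj₁ reach-y₀)) w₀~y₀ u₀≁w₀
        let reach-w = around⇒reach (∈-subset⁻ around? w∈Y) w∈b u₀≁w
            closed : ∀ {v t} → v ∈ X → t ∈ X → w ~ v → v ~ t → v ∈ Y × t ∈ Y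
            closed v∈X t∈X w~v v~t =
              let (around-v , around-t) = around-closed reach-w w∈b v∈X t∈X w~v v~t
              in ∈-subset⁺ around? around-v , ∈-subset⁺ around? around-t
        pure (w , HasMaxNeighbourIn-lift Y⊆X closed has , u₀≁w)

      ¬¬-result-whole : (∀ {x} → x ∈ X → x ∈ Y) → DoubleNegation Result
      ¬¬-result-whole X⊆Y = do
        attached? ← ¬¬-Decidable Attached
        (c , reach-c , c∉b , c~attached) ← ¬¬-common-neighbour (all-filter attached? (allFin n))
        ¬¬-result-dominating reach-c c∉b λ {s} s∈X u₀~s →
          All.lookup c~attached
            (∈-filter⁺ attached? (∈-allFin s) (neighbour-attached (∈-subset⁻ around? (X⊆Y s∈X)) u₀~s))
        where
        neighbour-attached : ∀ {s} → Around s → u₀ ~ s → Attached s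
        neighbour-attached (inj₁ reach)       u₀~s = contradiction u₀~s (far-≁ (reach⇒far reach))
        neighbour-attached (inj₂ (inj₁ att))  _    = att
        neighbour-attached (inj₂ (inj₂ refl)) u₀~u₀ = contradiction u₀~u₀ (irrefl G)

    ¬¬-result : DoubleNegation Result
    ¬¬-result = do
      around? ← ¬¬-Decidable Around
      no ¬proper ← ¬¬-excluded-middle {A = ∃ λ x → x ∈ X × x ∉ subset around?}
        where yes (_ , x∈X , x∉Y) → ¬¬-result-proper around? x∈X x∉Y
      ¬¬-result-whole around? λ {x} x∈X →
        decidable-stable (x ∈? subset around?) (λ x∉Y → ¬proper (x , x∈X , x∉Y))

  claim : ∀ X → Claim X
  claim = WF.All.wfRec ⊂-wellFounded 0ℓ Claim Step.¬¬-result

  ¬¬-max-neighbour-at : ∀ {w y} → w ~ y → side w ≡ b → DoubleNegation (∃ (HasMaxNeighbourIn ⊤))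
  ¬¬-max-neighbour-at {w} w~y w∈b = do
    inj₁ (w′ , has , _) ← ¬¬-avoiding-or-dominated (claim ⊤) ∈⊤ (adj-leaves w~y w∈b) ∈⊤ w∈b ∈⊤ w~y
      where inj₂ has → pure (w , has)
    pure (w′ , has)

  ¬¬-max-neighbour : HasEdge G → DoubleNegation (∃ (HasMaxNeighbourIn ⊤))
  ¬¬-max-neighbour (x , y , x~y) with side x Bool.≟ b
  ... | yes x∈b = ¬¬-max-neighbour-at x~y x∈b
  ... | no  x∉b = ¬¬-max-neighbour-at (symm G x~y) (adj-enters x~y x∉b)

-- Maximal stable sets

module _ {n} (G : Graph n) (adj? : ∀ x y → Dec (Adj G x y)) where

  open Adjacency G

  maximal-stable⇒dominating : ∀ {S} → IsMaximalStable G S → ∀ {x} → x ∉ S → ∃ λ z → z ∈ S × x ~ z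
  maximal-stable⇒dominating {S} (stable , maximal) {x} x∉S =
    decidable-stable (any? λ z → (z ∈? S) ×-dec adj? x z) λ ¬dominated →
      x∉S (maximal (subset T?) (stable-T ¬dominated) (∈-subset⁺ T? ∘ inj₁) (∈-subset⁺ T? (inj₂ refl)))
    where
    T? : Decidable (λ y → y ∈ S ⊎ y ≡ x)
    T? y = (y ∈? S) ⊎-dec (y Fin.≟ x)
    stable-T : ¬ (∃ λ z → z ∈ S × x ~ z) → IsStable G (subset T?)
    stable-T ¬dominated y z y∈T z∈T y~z with ∈-subset⁻ T? y∈T | ∈-subset⁻ T? z∈T
    ... | inj₁ y∈S  | inj₁ z∈S  = stable y z y∈S z∈S y~z
    ... | inj₁ y∈S  | inj₂ refl = ¬dominated (y , y∈S , symm G y~z)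
    ... | inj₂ refl | inj₁ z∈S  = ¬dominated (z , z∈S , y~z)
    ... | inj₂ refl | inj₂ refl = irrefl G y~z

  module Switch (side : Fin n → Bool) (bip : IsBipartition G side)
                {w u} (max : MaxNeighbourIn G ⊤ w u) where

    open Bipartite G side bip

    w~u : w ~ u
    w~u = proj₁ (proj₂ max)

    N[N[w]]⊆N[u] : ∀ {v t} → w ~ v → v ~ t → u ~ t
    N[N[w]]⊆N[u] = proj₂ (proj₂ max) ∈⊤ ∈⊤

    Kept : Subset n → Fin n → Set
    Kept S y = side y ≡ side u × y ∈ S × ¬ w ~ y

    Kept? : ∀ S → Decidable (Kept S)
    Kept? S y = (side y Bool.≟ side u) ×-dec (y ∈? S) ×-dec ¬? (adj? w y)

    Image : Subset n → Fin n → Set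
    Image S x = Kept S x ⊎ (side x ≢ side u × ¬ ∃ λ y → Kept S y × x ~ y)

    Image? : ∀ S → Decidable (Image S)
    Image? S x =
      Kept? S x ⊎-dec (¬? (side x Bool.≟ side u) ×-dec ¬? (any? λ y → Kept? S y ×-dec adj? x y))

    switch : Subset n → Subset n
    switch S = subset (Image? S)

    w∉side-u : side w ≢ side u
    w∉side-u = adj-leaves (symm G w~u) refl

    u∉switch : ∀ S → u ∉ switch S
    u∉switch S u∈ with ∈-subset⁻ (Image? S) u∈
    ... | inj₁ (_ , _ , w≁u) = w≁u w~u
    ... | inj₂ (u∉u , _)     = u∉u refl

    N[w]⊆S : ∀ {S} → IsMaximalStable G S → u ∈ S → ∀ {x} → w ~ x → x ∈ S
    N[w]⊆S {S} S-max u∈S {x} w~x = decidable-stable (x ∈? S) λ x∉S →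
      let (z , z∈S , x~z) = maximal-stable⇒dominating S-max x∉S
      in proj₁ S-max u z u∈S z∈S (N[N[w]]⊆N[u] w~x x~z)

    switch-stable : ∀ S → IsStable G (switch S)
    switch-stable S x y x∈ y∈ x~y with ∈-subset⁻ (Image? S) x∈ | ∈-subset⁻ (Image? S) y∈
    ... | inj₁ (x∈u , _)       | inj₁ (y∈u , _)       = adj-leaves x~y x∈u y∈u
    ... | inj₁ kept-x          | inj₂ (_ , ¬kept-nbr) = ¬kept-nbr (x , kept-x , symm G x~y)
    ... | inj₂ (_ , ¬kept-nbr) | inj₁ kept-y          = ¬kept-nbr (y , kept-y , x~y)
    ... | inj₂ (x∉u , _)       | inj₂ (y∉u , _)       = y∉u (adj-enters x~y x∉u)

    switch-maximal : ∀ {S} → IsMaximalStable G S → ∀ T → IsStable G T → switch S ⊆ T → T ⊆ switch S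
    switch-maximal {S} S-max T T-stable switch⊆T {x} x∈T = decidable-stable (x ∈? switch S) λ x∉ →
      let (y , y∈ , x~y) = outside-neighbour x∉ in T-stable x y x∈T (switch⊆T y∈) x~y
      where
      image : ∀ {y} → Image S y → y ∈ switch S
      image = ∈-subset⁺ (Image? S)
      outside-neighbour : ∀ {x} → x ∉ switch S → ∃ λ y → y ∈ switch S × x ~ y
      outside-neighbour {x} x∉ with side x Bool.≟ side u | x ∈? S
      ... | yes x∈u | yes x∈S = w , image (inj₂ (w∉side-u , λ (_ , (_ , _ , w≁y) , w~y) → w≁y w~y)) ,
          symm G (decidable-stable (adj? w x) (λ w≁x → x∉ (image (inj₁ (x∈u , x∈S , w≁x)))))
      ... | yes x∈u | no  x∉S = let (z , z∈S , x~z) = maximal-stable⇒dominating S-max x∉S in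
          z , image (inj₂ (adj-leaves x~z x∈u , λ (y , (_ , y∈S , _) , z~y) → proj₁ S-max z y z∈S y∈S z~y)) ,
          x~z
      ... | no  x∉u | _ =
          let (y , kept-y , x~y) = decidable-stable (any? λ y → Kept? S y ×-dec adj? x y)
                                     (λ ¬kept-nbr → x∉ (image (inj₂ (x∉u , ¬kept-nbr))))
          in y , image (inj₁ kept-y) , x~y

    ∈-transfer : ∀ {S₁ S₂} → IsMaximalStable G S₂ → u ∈ S₂ → switch S₁ ≡ switch S₂ →
                 ∀ {y} → side y ≡ side u → y ∈ S₁ → y ∈ S₂
    ∈-transfer {S₁} {S₂} S₂-max u∈S₂ eq {y} y∈u y∈S₁ with adj? w y
    ... | yes w~y = N[w]⊆S S₂-max u∈S₂ w~y
    ... | no  w≁y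
      with ∈-subset⁻ (Image? S₂) (subst (y ∈_) eq (∈-subset⁺ (Image? S₁) (inj₁ (y∈u , y∈S₁ , w≁y))))
    ...   | inj₁ (_ , y∈S₂ , _) = y∈S₂
    ...   | inj₂ (y∉u , _)      = contradiction y∈u y∉u

    switch-injective : ∀ {S₁ S₂} → IsMaximalStable G S₁ → IsMaximalStable G S₂ → u ∈ S₁ → u ∈ S₂ →
                       switch S₁ ≡ switch S₂ → S₁ ⊆ S₂
    switch-injective {S₁} {S₂} S₁-max S₂-max u∈S₁ u∈S₂ eq {x} x∈S₁ with side x Bool.≟ side u
    ... | yes x∈u = ∈-transfer S₂-max u∈S₂ eq x∈u x∈S₁
    ... | no  x∉u = decidable-stable (x ∈? S₂) λ x∉S₂ →
      let (z , z∈S₂ , x~z) = maximal-stable⇒dominating S₂-max x∉S₂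
      in proj₁ S₁-max x z x∈S₁ (∈-transfer S₁-max u∈S₁ (sym eq) (adj-enters x~z x∉u) z∈S₂) x~z

    at-most-half : (L : List (Subset n)) → EnumeratesMaxStable G L → AtMostHalf u L
    at-most-half L (L! , enumerates) = 2*length-filter≤length (u ∈?_) switch L L! to-avoiding injective
      where
      maximal : ∀ {S} → S ∈ₗ L → IsMaximalStable G S
      maximal = Equivalence.to (enumerates _)
      to-avoiding : ∀ {S} → S ∈ₗ L → u ∈ S → switch S ∈ₗ L × u ∉ switch S
      to-avoiding {S} S∈L u∈S = Equivalence.from (enumerates (switch S))
        (switch-stable S , switch-maximal (maximal S∈L)) , u∉switch S
      injective : ∀ {S₁ S₂} → S₁ ∈ₗ L → S₂ ∈ₗ L → u ∈ S₁ → u ∈ S₂ → switch S₁ ≡ switch S₂ → S₁ ≡ S₂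
      injective S₁∈L S₂∈L u∈S₁ u∈S₂ eq = ⊆-antisym
        (switch-injective (maximal S₁∈L) (maximal S₂∈L) u∈S₁ u∈S₂ eq)
        (switch-injective (maximal S₂∈L) (maximal S₁∈L) u∈S₂ u∈S₁ (sym eq))

class-at-most-half? : ∀ {n} (side : Fin n → Bool) (c : Bool) (L : List (Subset n)) →
                      Dec (∃[ u ] (side u ≡ c × AtMostHalf u L))
class-at-most-half? side c L = any? λ u → (side u Bool.≟ c) ×-dec (2 * countContaining u L ≤? length L)

theorem9 : (n : ℕ) (G : Graph n) (side : Fin n → Bool) →
    ChordalBipartite G side → HasEdge G →
    (L : List (Subset n)) → EnumeratesMaxStable G L →
    (∃[ u ] (side u ≡ false × AtMostHalf u L)) × (∃[ w ] (side w ≡ true × AtMostHalf w L))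
theorem9 n G side (bip , chordal) edge L enumerates =
  decidable-stable (class-at-most-half? side false L ×-dec class-at-most-half? side true L) do
    adj? ← ¬¬-Π λ x → ¬¬-Decidable (Adj G x)
    let module M = MaximumNeighbours G side bip chordal adj?
        half : ∀ b → ∃ (M.HasMaxNeighbourIn b ⊤) → ∃[ u ] (side u ≡ not b × AtMostHalf u L)
        half b (_ , _ , w∈b , u , max) =
          u , ¬-not (Bipartite.adj-leaves G side bip (proj₁ (proj₂ max)) w∈b) ,
          Switch.at-most-half G adj? side bip max L enumerates
    has-true  ← M.¬¬-max-neighbour true edge
    has-false ← M.¬¬-max-neighbour false edge
    pure (half true has-true , half false has-false)
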